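{- Let $G$ be a simple graph with $n$ vertices, and let $S_{i,k}(G)$ and $M_2^{(p)}(G)$ be as defined in the context. Then for every natural number $p$, $$M_2^{(p)}(G)=\sum_{i=0}^{n-2} \sum_{k=i}^{n-2} i!\, k! \left\{ {p+1 \atop i+1}\right\} \left\{ {p+1 \atop k+1}\right\}S_{i,k}(G),$$ where $\left\{ {m \atop j}\right\}$ denotes the Stirling number of the second kind.
   Context: $G$ is a finite simple graph with $n$ vertices and edge set $E(G)$; $d_v$ denotes the degree of a vertex $v$. The general second Zagreb index is $M_2^{(p)}(G)=\sum_{\{u,v\}\in E(G)} (d_u d_v)^p$. For integers $0\le a\le b$, $$S_{a,b}(G)=\begin{cases} \displaystyle \sum_{\{u,v\} \in E(G)} \left( \binom{d_u-1}{a}\binom{d_v-1}{b}+ \binom{d_u-1}{b}\binom{d_v-1}{a} \right), & a < b,\\ \displaystyle \sum_{\{u,v\} \in E(G)} \binom{d_u-1}{a}\binom{d_v-1}{a}, & a = b, \end{cases}$$ with $\binom{x}{k}=0$ for $k>x$. -}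

module Defs where

open import Data.Nat using (ℕ; zero; suc; _+_; _*_; _∸_; _^_; _<ᵇ_)
open import Data.Nat.Combinatorics using (_C_)
open import Data.Bool using (Bool; true; false; if_then_else_)
open import Data.Fin using (Fin; toℕ)
open import Data.List using (List; map; upTo; allFin)
open import Data.Nat.ListAction using (sum)
open import Relation.Binary.PropositionalEquality using (_≡_)

record SimpleGraph (n : ℕ) : Set where
  field
    adj     : Fin n → Fin n → Bool
    sym     : ∀ u v → adj u v ≡ adj v u
    irrefl  : ∀ v → adj v v ≡ false
open SimpleGraph public

ΣFin : (n : ℕ) → (Fin n → ℕ) → ℕ
ΣFin n f = sum (map f (allFin n))

deg : {n : ℕ} → SimpleGraph n → Fin n → ℕ
deg {n} G v = ΣFin n (λ w → if adj G v w then 1 else 0)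

-- Sum over the edge set E(G): each edge {u,v} counted once, as the pair u < v.
ΣEdges : {n : ℕ} → SimpleGraph n → (Fin n → Fin n → ℕ) → ℕ
ΣEdges {n} G f =
  ΣFin n (λ u → ΣFin n (λ v →
    if adj G u v then (if toℕ u <ᵇ toℕ v then f u v else 0) else 0))

M2 : {n : ℕ} → ℕ → SimpleGraph n → ℕ
M2 p G = ΣEdges G (λ u v → (deg G u * deg G v) ^ p)

-- S_{a,b}(G) (binomial with n C k = 0 for k > n, as in stdlib)
S : {n : ℕ} → ℕ → ℕ → SimpleGraph n → ℕ
S a b G = ΣEdges G (λ u v → term (deg G u ∸ 1) (deg G v ∸ 1))
  where
  term : ℕ → ℕ → ℕ
  term x y = if a <ᵇ b
             then ((x C a) * (y C b) + (x C b) * (y C a))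
             else ((x C a) * (y C a))

stirling2 : ℕ → ℕ → ℕ
stirling2 zero    zero    = 1
stirling2 zero    (suc j) = 0
stirling2 (suc m) zero    = 0
stirling2 (suc m) (suc j) = suc j * stirling2 m (suc j) + stirling2 m j

-- Σ_{i = lo}^{hi-1} f i  (empty if hi ≤ lo)
ΣRange : ℕ → ℕ → (ℕ → ℕ) → ℕ
ΣRange lo hi f = sum (map (λ d → f (lo + d)) (upTo (hi ∸ lo)))

-- Write d_u = x + 1 and d_v = y + 1. The Stirling expansion
-- (x + 1)^p = Σ_i i! {p+1 \atop i+1} C(x, i) (Pascal's rule and absorption
-- C(x+1, i+1)(i+1) = (x+1) C(x, i) carry it through the Stirling recurrence)
-- has only terms with i ≤ x ≤ n - 2, because d_u ≤ n - 1.  Multiplying the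
-- expansions for d_u and d_v and grouping the terms (i, k) and (k, i) gives
-- (d_u d_v)^p as a sum over i ≤ k of the edge summands of S_{i,k}; summing over
-- the edges and exchanging the finite sums yields the theorem.
module Submission where

open import Defs renaming (sym to adj-sym)
open import Data.Bool using (Bool; true; false; if_then_else_)
open import Data.Fin using (Fin; toℕ)
open import Data.List using (List; []; _∷_; map; length; applyUpTo; allFin)
open import Data.List.Membership.Propositional using (_∈_)
open import Data.List.Membership.Propositional.Properties using (∈-allFin)
open import Data.List.Properties using (map-cong; length-tabulate)
open import Data.List.Relation.Unary.Any using (here; there)
open import Data.Nat using (ℕ; zero; suc; _+_; _*_; _∸_; _^_; _!; _≤_; _<_; _<ᵇ_; z≤n; s≤s)
open import Data.Nat.Combinatorics using (_C_; nCk+nC[k+1]≡[n+1]C[k+1]; k>n⇒nCk≡0; nC1≡n)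
open import Data.Nat.ListAction using (sum)
open import Data.Nat.Properties
open import Algebra.Properties.CommutativeSemigroup +-commutativeSemigroup
  using () renaming (interchange to +-interchange)
open import Data.Nat.Tactic.RingSolver using (solve-∀)
open import Function using (_∘_)
open import Relation.Binary.PropositionalEquality
open ≡-Reasoning

Σ< : ℕ → (ℕ → ℕ) → ℕ
Σ< zero    f = 0
Σ< (suc M) f = f 0 + Σ< M (f ∘ suc)

Σ<-cong : ∀ M {f g : ℕ → ℕ} → (∀ i → f i ≡ g i) → Σ< M f ≡ Σ< M g
Σ<-cong zero    eq = refl
Σ<-cong (suc M) eq = cong₂ _+_ (eq 0) (Σ<-cong M (eq ∘ suc))

Σ<-+ : ∀ M (f g : ℕ → ℕ) → Σ< M (λ i → f i + g i) ≡ Σ< M f + Σ< M g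
Σ<-+ zero    f g = refl
Σ<-+ (suc M) f g = begin
  f 0 + g 0 + Σ< M (λ i → f (suc i) + g (suc i))
    ≡⟨ cong (f 0 + g 0 +_) (Σ<-+ M (f ∘ suc) (g ∘ suc)) ⟩
  f 0 + g 0 + (Σ< M (f ∘ suc) + Σ< M (g ∘ suc))
    ≡⟨ +-interchange (f 0) (g 0) _ _ ⟩
  f 0 + Σ< M (f ∘ suc) + (g 0 + Σ< M (g ∘ suc)) ∎

Σ<-*ˡ : ∀ M c (f : ℕ → ℕ) → Σ< M (λ i → c * f i) ≡ c * Σ< M f
Σ<-*ˡ zero    c f = sym (*-zeroʳ c)
Σ<-*ˡ (suc M) c f = trans (cong (c * f 0 +_) (Σ<-*ˡ M c (f ∘ suc)))
                          (sym (*-distribˡ-+ c (f 0) _))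

Σ<-zero : ∀ M {f : ℕ → ℕ} → (∀ i → f i ≡ 0) → Σ< M f ≡ 0
Σ<-zero zero    eq = refl
Σ<-zero (suc M) eq = cong₂ _+_ (eq 0) (Σ<-zero M (eq ∘ suc))

Σ<-snoc : ∀ M (f : ℕ → ℕ) → Σ< (suc M) f ≡ Σ< M f + f M
Σ<-snoc zero    f = +-comm (f 0) 0
Σ<-snoc (suc M) f = trans (cong (f 0 +_) (Σ<-snoc M (f ∘ suc)))
                          (sym (+-assoc (f 0) _ _))

sum-map-applyUpTo : ∀ M (f g : ℕ → ℕ) → sum (map f (applyUpTo g M)) ≡ Σ< M (f ∘ g)
sum-map-applyUpTo zero    f g = refl
sum-map-applyUpTo (suc M) f g = cong (f (g 0) +_) (sum-map-applyUpTo M f (g ∘ suc))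

ΣRange≡Σ< : ∀ lo hi f → ΣRange lo hi f ≡ Σ< (hi ∸ lo) (λ d → f (lo + d))
ΣRange≡Σ< lo hi f = sum-map-applyUpTo (hi ∸ lo) (λ d → f (lo + d)) (λ d → d)

Σ△ : ℕ → (ℕ → ℕ → ℕ) → ℕ
Σ△ M F = Σ< M (λ i → Σ< (M ∸ i) (λ d → F i (i + d)))

Σ△-cong : ∀ M {F G : ℕ → ℕ → ℕ} → (∀ i k → F i k ≡ G i k) → Σ△ M F ≡ Σ△ M G
Σ△-cong M eq = Σ<-cong M (λ i → Σ<-cong (M ∸ i) (λ d → eq i (i + d)))

ΣRange≡Σ△ : ∀ M F → ΣRange 0 M (λ i → ΣRange i M (F i)) ≡ Σ△ M F
ΣRange≡Σ△ M F = trans (ΣRange≡Σ< 0 M _) (Σ<-cong M (λ i → ΣRange≡Σ< i M (F i)))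

-- With a = (x C_) and b = (y C_) this is definitionally the edge summand of S i k.
symProd : (ℕ → ℕ) → (ℕ → ℕ) → ℕ → ℕ → ℕ
symProd a b i k = if i <ᵇ k then a i * b k + a k * b i else a i * b i

Σ<*Σ<≡Σ△symProd : ∀ M (a b : ℕ → ℕ) → Σ< M a * Σ< M b ≡ Σ△ M (symProd a b)
Σ<*Σ<≡Σ△symProd zero    a b = refl
Σ<*Σ<≡Σ△symProd (suc M) a b = sym (begin
  a 0 * b 0 + Σ< M (λ k → a 0 * b' k + a' k * b 0) + Σ△ M (symProd a' b')
    ≡⟨ cong (λ z → a 0 * b 0 + z + Σ△ M (symProd a' b')) cross ⟩
  a 0 * b 0 + (a 0 * Σ< M b' + b 0 * Σ< M a') + Σ△ M (symProd a' b')
    ≡⟨ cong (a 0 * b 0 + (a 0 * Σ< M b' + b 0 * Σ< M a') +_) (sym (Σ<*Σ<≡Σ△symProd M a' b')) ⟩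
  a 0 * b 0 + (a 0 * Σ< M b' + b 0 * Σ< M a') + Σ< M a' * Σ< M b'
    ≡⟨ expand (a 0) (b 0) (Σ< M a') (Σ< M b') ⟩
  (a 0 + Σ< M a') * (b 0 + Σ< M b') ∎)
  where
  a' b' : ℕ → ℕ
  a' = a ∘ suc
  b' = b ∘ suc
  cross : Σ< M (λ k → a 0 * b' k + a' k * b 0) ≡ a 0 * Σ< M b' + b 0 * Σ< M a'
  cross = trans (Σ<-+ M (λ k → a 0 * b' k) (λ k → a' k * b 0))
                (cong₂ _+_ (Σ<-*ˡ M (a 0) b')
                           (trans (Σ<-cong M (λ k → *-comm (a' k) (b 0))) (Σ<-*ˡ M (b 0) a')))
  expand : ∀ x y X Y → x * y + (x * Y + y * X) + X * Y ≡ (x + X) * (y + Y)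
  expand = solve-∀

<ᵇ-irrefl : ∀ i → (i <ᵇ i) ≡ false
<ᵇ-irrefl zero    = refl
<ᵇ-irrefl (suc i) = <ᵇ-irrefl i

<ᵇ-+suc : ∀ i d → (i <ᵇ i + suc d) ≡ true
<ᵇ-+suc zero    d = refl
<ᵇ-+suc (suc i) d = <ᵇ-+suc i d

symProd-scale : ∀ (c a b : ℕ → ℕ) i d →
  symProd (λ j → c j * a j) (λ j → c j * b j) i (i + d) ≡ c i * c (i + d) * symProd a b i (i + d)
symProd-scale c a b i zero rewrite +-identityʳ i | <ᵇ-irrefl i = diagonal (c i) (a i) (b i)
  where
  diagonal : ∀ ci ai bi → ci * ai * (ci * bi) ≡ ci * ci * (ai * bi)
  diagonal = solve-∀
symProd-scale c a b i (suc d) rewrite <ᵇ-+suc i d =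
  off-diagonal (c i) (c (i + suc d)) (a i) (b (i + suc d)) (a (i + suc d)) (b i)
  where
  off-diagonal : ∀ ci ck ai bk ak bi →
    ci * ai * (ck * bk) + ck * ak * (ci * bi) ≡ ci * ck * (ai * bk + ak * bi)
  off-diagonal = solve-∀

[k+1]*[n+1]C[k+1]≡[n+1]*nCk : ∀ n k → suc k * (suc n C suc k) ≡ suc n * (n C k)
[k+1]*[n+1]C[k+1]≡[n+1]*nCk zero zero = refl
[k+1]*[n+1]C[k+1]≡[n+1]*nCk zero (suc k) =
  trans (cong (suc (suc k) *_) (k>n⇒nCk≡0 {1} {suc (suc k)} (s≤s (s≤s z≤n)))) (*-zeroʳ (suc (suc k)))
[k+1]*[n+1]C[k+1]≡[n+1]*nCk (suc n) zero =
  trans (+-identityʳ _) (trans (nC1≡n (suc (suc n))) (sym (*-identityʳ _)))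
[k+1]*[n+1]C[k+1]≡[n+1]*nCk (suc n) (suc k) = begin
  suc (suc k) * (suc (suc n) C suc (suc k))
    ≡⟨ cong (suc (suc k) *_) (sym (nCk+nC[k+1]≡[n+1]C[k+1] (suc n) (suc k))) ⟩
  suc (suc k) * (P + Q)
    ≡⟨ *-distribˡ-+ (suc (suc k)) P Q ⟩
  P + suc k * P + suc (suc k) * Q
    ≡⟨ cong₂ (λ z w → P + z + w) ([k+1]*[n+1]C[k+1]≡[n+1]*nCk n k)
                                  ([k+1]*[n+1]C[k+1]≡[n+1]*nCk n (suc k)) ⟩
  P + suc n * (n C k) + suc n * (n C suc k)
    ≡⟨ +-assoc P _ _ ⟩
  P + (suc n * (n C k) + suc n * (n C suc k))
    ≡⟨ cong (P +_) (sym (*-distribˡ-+ (suc n) (n C k) (n C suc k))) ⟩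
  P + suc n * (n C k + n C suc k)
    ≡⟨ cong (λ z → P + suc n * z) (nCk+nC[k+1]≡[n+1]C[k+1] n k) ⟩
  P + suc n * P ∎
  where
  P Q : ℕ
  P = suc n C suc k
  Q = suc n C suc (suc k)

stirlingWeight : ℕ → ℕ → ℕ
stirlingWeight p i = i ! * stirling2 (suc p) (suc i)

suc^≡Σ<stirlingWeight*C : ∀ p x M → x < M →
  suc x ^ p ≡ Σ< M (λ i → stirlingWeight p i * (x C i))
suc^≡Σ<stirlingWeight*C zero x (suc M) _ =
  sym (cong suc (Σ<-zero M (λ i → higher-vanish i)))
  where
  higher-vanish : ∀ i → suc i ! * stirling2 1 (suc (suc i)) * (x C suc i) ≡ 0
  higher-vanish i rewrite *-zeroʳ (suc (suc i)) | *-zeroʳ (suc i !) = refl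
suc^≡Σ<stirlingWeight*C (suc p) x (suc M) x<1+M = sym (begin
  Σ< (suc M) (λ i → stirlingWeight (suc p) i * (x C i))
    ≡⟨ Σ<-cong (suc M) (λ i → split i) ⟩
  Σ< (suc M) (λ i → a i * (x C i) + i ! * s i * (x C i))
    ≡⟨ Σ<-+ (suc M) (λ i → a i * (x C i)) (λ i → i ! * s i * (x C i)) ⟩
  Σ< (suc M) (λ i → a i * (x C i)) + Σ< M (λ i → a i * (x C suc i))
    ≡⟨ cong (Σ< (suc M) (λ i → a i * (x C i)) +_) extend ⟩
  Σ< (suc M) (λ i → a i * (x C i)) + Σ< (suc M) (λ i → a i * (x C suc i))
    ≡⟨ sym (Σ<-+ (suc M) (λ i → a i * (x C i)) (λ i → a i * (x C suc i))) ⟩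
  Σ< (suc M) (λ i → a i * (x C i) + a i * (x C suc i))
    ≡⟨ Σ<-cong (suc M) (λ i → absorb i) ⟩
  Σ< (suc M) (λ i → suc x * (stirlingWeight p i * (x C i)))
    ≡⟨ Σ<-*ˡ (suc M) (suc x) (λ i → stirlingWeight p i * (x C i)) ⟩
  suc x * Σ< (suc M) (λ i → stirlingWeight p i * (x C i))
    ≡⟨ cong (suc x *_) (sym (suc^≡Σ<stirlingWeight*C p x (suc M) x<1+M)) ⟩
  suc x * suc x ^ p ∎)
  where
  s : ℕ → ℕ
  s = stirling2 (suc p)
  a : ℕ → ℕ
  a i = suc i ! * s (suc i)
  split : ∀ i → stirlingWeight (suc p) i * (x C i) ≡ a i * (x C i) + i ! * s i * (x C i)
  split i = distrib (i !) (suc i) (s (suc i)) (s i) (x C i)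
    where
    distrib : ∀ f j t u c → f * (j * t + u) * c ≡ (j * f) * t * c + f * u * c
    distrib = solve-∀
  extend : Σ< M (λ i → a i * (x C suc i)) ≡ Σ< (suc M) (λ i → a i * (x C suc i))
  extend = sym (begin
    Σ< (suc M) (λ i → a i * (x C suc i))
      ≡⟨ Σ<-snoc M (λ i → a i * (x C suc i)) ⟩
    Σ< M (λ i → a i * (x C suc i)) + a M * (x C suc M)
      ≡⟨ cong (λ z → Σ< M (λ i → a i * (x C suc i)) + a M * z) (k>n⇒nCk≡0 x<1+M) ⟩
    Σ< M (λ i → a i * (x C suc i)) + a M * 0
      ≡⟨ cong (Σ< M (λ i → a i * (x C suc i)) +_) (*-zeroʳ (a M)) ⟩
    Σ< M (λ i → a i * (x C suc i)) + 0
      ≡⟨ +-identityʳ _ ⟩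
    Σ< M (λ i → a i * (x C suc i)) ∎)
  absorb : ∀ i → a i * (x C i) + a i * (x C suc i) ≡ suc x * (stirlingWeight p i * (x C i))
  absorb i = begin
    a i * (x C i) + a i * (x C suc i)
      ≡⟨ sym (*-distribˡ-+ (a i) (x C i) (x C suc i)) ⟩
    a i * (x C i + x C suc i)
      ≡⟨ cong (a i *_) (nCk+nC[k+1]≡[n+1]C[k+1] x i) ⟩
    a i * (suc x C suc i)
      ≡⟨ regroup (suc i) (i !) (s (suc i)) (suc x C suc i) ⟩
    i ! * s (suc i) * (suc i * (suc x C suc i))
      ≡⟨ cong (i ! * s (suc i) *_) ([k+1]*[n+1]C[k+1]≡[n+1]*nCk x i) ⟩
    i ! * s (suc i) * (suc x * (x C i))
      ≡⟨ regroup' (i ! * s (suc i)) (suc x) (x C i) ⟩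
    suc x * (stirlingWeight p i * (x C i)) ∎
    where
    regroup : ∀ j f t c → j * f * t * c ≡ f * t * (j * c)
    regroup = solve-∀
    regroup' : ∀ w y c → w * (y * c) ≡ y * (w * c)
    regroup' = solve-∀

^-distrib-* : ∀ m n p → (m * n) ^ p ≡ m ^ p * n ^ p
^-distrib-* m n zero    = refl
^-distrib-* m n (suc p) =
  trans (cong (m * n *_) (^-distrib-* m n p)) ([m*n]*[o*p]≡[m*o]*[n*p] m n (m ^ p) (n ^ p))

product^-expansion : ∀ {N} p {du dv} → 0 < du → du < N → 0 < dv → dv < N →
  (du * dv) ^ p ≡
    Σ△ (N ∸ 1) (λ i k → stirlingWeight p i * stirlingWeight p k *
                        symProd ((du ∸ 1) C_) ((dv ∸ 1) C_) i k)
product^-expansion {suc M} p {suc x} {suc y} _ (s≤s x<M) _ (s≤s y<M) = begin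
  (suc x * suc y) ^ p
    ≡⟨ ^-distrib-* (suc x) (suc y) p ⟩
  suc x ^ p * suc y ^ p
    ≡⟨ cong₂ _*_ (suc^≡Σ<stirlingWeight*C p x M x<M) (suc^≡Σ<stirlingWeight*C p y M y<M) ⟩
  Σ< M (λ i → stirlingWeight p i * (x C i)) * Σ< M (λ i → stirlingWeight p i * (y C i))
    ≡⟨ Σ<*Σ<≡Σ△symProd M _ _ ⟩
  Σ△ M (symProd (λ i → stirlingWeight p i * (x C i)) (λ i → stirlingWeight p i * (y C i)))
    ≡⟨ Σ<-cong M (λ i → Σ<-cong (M ∸ i) (symProd-scale (stirlingWeight p) (x C_) (y C_) i)) ⟩
  Σ△ M (λ i k → stirlingWeight p i * stirlingWeight p k * symProd (x C_) (y C_) i k) ∎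

module _ {A : Set} where

  sum-map-+ : ∀ (xs : List A) (f g : A → ℕ) →
    sum (map (λ x → f x + g x) xs) ≡ sum (map f xs) + sum (map g xs)
  sum-map-+ []       f g = refl
  sum-map-+ (x ∷ xs) f g = trans (cong (f x + g x +_) (sum-map-+ xs f g)) (+-interchange (f x) (g x) _ _)

  sum-map-*ˡ : ∀ (xs : List A) c (f : A → ℕ) → sum (map (λ x → c * f x) xs) ≡ c * sum (map f xs)
  sum-map-*ˡ []       c f = sym (*-zeroʳ c)
  sum-map-*ˡ (x ∷ xs) c f = trans (cong (c * f x +_) (sum-map-*ˡ xs c f)) (sym (*-distribˡ-+ c (f x) _))

  sum-map-cong : ∀ (xs : List A) {f g : A → ℕ} → (∀ x → f x ≡ g x) → sum (map f xs) ≡ sum (map g xs)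
  sum-map-cong xs eq = cong sum (map-cong eq xs)

  ∈⇒≤sum-map : ∀ (f : A → ℕ) {x xs} → x ∈ xs → f x ≤ sum (map f xs)
  ∈⇒≤sum-map f (here refl) = m≤m+n _ _
  ∈⇒≤sum-map f (there x∈xs) = ≤-trans (∈⇒≤sum-map f x∈xs) (m≤n+m _ _)

  module _ {f : A → ℕ} (f≤1 : ∀ x → f x ≤ 1) where

    sum-map-≤-length : ∀ xs → sum (map f xs) ≤ length xs
    sum-map-≤-length []       = z≤n
    sum-map-≤-length (x ∷ xs) = +-mono-≤ (f≤1 x) (sum-map-≤-length xs)

    sum-map-<-length : ∀ {x xs} → x ∈ xs → f x ≡ 0 → sum (map f xs) < length xs
    sum-map-<-length {xs = _ ∷ xs} (here refl) fx≡0 rewrite fx≡0 = s≤s (sum-map-≤-length xs)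
    sum-map-<-length (there x∈xs) fx≡0 = +-mono-≤-< (f≤1 _) (sum-map-<-length x∈xs fx≡0)

masked : Bool → ℕ → ℕ
masked b x = if b then x else 0

masked-+ : ∀ b x y → masked b (x + y) ≡ masked b x + masked b y
masked-+ true  x y = refl
masked-+ false x y = refl

masked-*ˡ : ∀ b c x → masked b (c * x) ≡ c * masked b x
masked-*ˡ true  c x = refl
masked-*ˡ false c x = sym (*-zeroʳ c)

module _ {n : ℕ} (G : SimpleGraph n) where

  onEdge : Fin n → Fin n → ℕ → ℕ
  onEdge u v x = masked (adj G u v) (masked (toℕ u <ᵇ toℕ v) x)

  ΣEdges-+ : ∀ (f g : Fin n → Fin n → ℕ) →
    ΣEdges G (λ u v → f u v + g u v) ≡ ΣEdges G f + ΣEdges G g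
  ΣEdges-+ f g =
    trans (sum-map-cong (allFin n) (λ u →
             trans (sum-map-cong (allFin n) (λ v → onEdge-+ u v))
                   (sum-map-+ (allFin n) (λ v → onEdge u v (f u v)) (λ v → onEdge u v (g u v)))))
          (sum-map-+ (allFin n) _ _)
    where
    onEdge-+ : ∀ u v → onEdge u v (f u v + g u v) ≡ onEdge u v (f u v) + onEdge u v (g u v)
    onEdge-+ u v = trans (cong (masked (adj G u v)) (masked-+ (toℕ u <ᵇ toℕ v) _ _))
                         (masked-+ (adj G u v) _ _)

  ΣEdges-*ˡ : ∀ c (f : Fin n → Fin n → ℕ) → ΣEdges G (λ u v → c * f u v) ≡ c * ΣEdges G f
  ΣEdges-*ˡ c f =
    trans (sum-map-cong (allFin n) (λ u →
             trans (sum-map-cong (allFin n) (λ v → onEdge-*ˡ u v))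
                   (sum-map-*ˡ (allFin n) c (λ v → onEdge u v (f u v)))))
          (sum-map-*ˡ (allFin n) c _)
    where
    onEdge-*ˡ : ∀ u v → onEdge u v (c * f u v) ≡ c * onEdge u v (f u v)
    onEdge-*ˡ u v = trans (cong (masked (adj G u v)) (masked-*ˡ (toℕ u <ᵇ toℕ v) c _))
                          (masked-*ˡ (adj G u v) c _)

  ΣEdges-zero : ΣEdges G (λ _ _ → 0) ≡ 0
  ΣEdges-zero = ΣEdges-*ˡ 0 (λ _ _ → 0)

  ΣEdges-Σ< : ∀ M (h : ℕ → Fin n → Fin n → ℕ) →
    ΣEdges G (λ u v → Σ< M (λ i → h i u v)) ≡ Σ< M (λ i → ΣEdges G (h i))
  ΣEdges-Σ< zero    h = ΣEdges-zero
  ΣEdges-Σ< (suc M) h = trans (ΣEdges-+ (h 0) (λ u v → Σ< M (λ i → h (suc i) u v)))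
                              (cong (ΣEdges G (h 0) +_) (ΣEdges-Σ< M (h ∘ suc)))

  ΣEdges-Σ△ : ∀ M (H : ℕ → ℕ → Fin n → Fin n → ℕ) →
    ΣEdges G (λ u v → Σ△ M (λ i k → H i k u v)) ≡ Σ△ M (λ i k → ΣEdges G (H i k))
  ΣEdges-Σ△ M H = trans (ΣEdges-Σ< M (λ i u v → Σ< (M ∸ i) (λ d → H i (i + d) u v)))
                        (Σ<-cong M (λ i → ΣEdges-Σ< (M ∸ i) (λ d → H i (i + d))))

  ΣEdges-cong : ∀ {f g : Fin n → Fin n → ℕ} →
    (∀ u v → adj G u v ≡ true → f u v ≡ g u v) → ΣEdges G f ≡ ΣEdges G g
  ΣEdges-cong {f} {g} eq =
    sum-map-cong (allFin n) (λ u → sum-map-cong (allFin n) (λ v → onEdge-cong u v))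
    where
    onEdge-cong : ∀ u v → onEdge u v (f u v) ≡ onEdge u v (g u v)
    onEdge-cong u v with adj G u v in uv
    ... | true  = cong (masked (toℕ u <ᵇ toℕ v)) (eq u v uv)
    ... | false = refl

  adjacency≤1 : ∀ u w → masked (adj G u w) 1 ≤ 1
  adjacency≤1 u w with adj G u w
  ... | true  = ≤-refl
  ... | false = z≤n

  deg-pos : ∀ {u v} → adj G u v ≡ true → 0 < deg G u
  deg-pos {u} {v} uv =
    subst (λ b → masked b 1 ≤ deg G u) uv (∈⇒≤sum-map (λ w → masked (adj G u w) 1) (∈-allFin v))

  deg<n : ∀ u → deg G u < n
  deg<n u = subst (deg G u <_) (length-tabulate (λ w → w))
    (sum-map-<-length (adjacency≤1 u) (∈-allFin u) (cong (λ b → masked b 1) (irrefl G u)))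

  edge^-expansion : ∀ p {u v} → adj G u v ≡ true →
    (deg G u * deg G v) ^ p ≡
      Σ△ (n ∸ 1) (λ i k → stirlingWeight p i * stirlingWeight p k *
                          symProd ((deg G u ∸ 1) C_) ((deg G v ∸ 1) C_) i k)
  edge^-expansion p {u} {v} uv =
    product^-expansion p (deg-pos uv) (deg<n u) (deg-pos (trans (adj-sym G v u) uv)) (deg<n v)

stirlingWeight*stirlingWeight : ∀ p i k →
  i ! * k ! * stirling2 (p + 1) (i + 1) * stirling2 (p + 1) (k + 1) ≡
    stirlingWeight p i * stirlingWeight p k
stirlingWeight*stirlingWeight p i k rewrite +-comm p 1 | +-comm i 1 | +-comm k 1 =
  regroup (i !) (k !) (stirling2 (suc p) (suc i)) (stirling2 (suc p) (suc k))
  where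
  regroup : ∀ a b c d → a * b * c * d ≡ a * c * (b * d)
  regroup = solve-∀

theorem2 : (n : ℕ) (G : SimpleGraph n) (p : ℕ) →
    M2 p G ≡
      ΣRange 0 (n ∸ 1) (λ i → ΣRange i (n ∸ 1) (λ k →
        (i !) * (k !) * stirling2 (p + 1) (i + 1) * stirling2 (p + 1) (k + 1) * S i k G))
theorem2 n G p = begin
  M2 p G
    ≡⟨ ΣEdges-cong G (λ u v → edge^-expansion G p) ⟩
  ΣEdges G (λ u v → Σ△ M (λ i k → H i k u v))
    ≡⟨ ΣEdges-Σ△ G M H ⟩
  Σ△ M (λ i k → ΣEdges G (H i k))
    ≡⟨ Σ△-cong M (λ i k → ΣEdges-*ˡ G (w i * w k) (edgeSummand i k)) ⟩
  Σ△ M (λ i k → w i * w k * S i k G)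
    ≡⟨ Σ△-cong M (λ i k → cong (_* S i k G) (sym (stirlingWeight*stirlingWeight p i k))) ⟩
  Σ△ M F
    ≡⟨ sym (ΣRange≡Σ△ M F) ⟩
  ΣRange 0 M (λ i → ΣRange i M (F i)) ∎
  where
  M = n ∸ 1
  w = stirlingWeight p
  edgeSummand : ℕ → ℕ → Fin n → Fin n → ℕ
  edgeSummand i k u v = symProd ((deg G u ∸ 1) C_) ((deg G v ∸ 1) C_) i k
  H : ℕ → ℕ → Fin n → Fin n → ℕ
  H i k u v = w i * w k * edgeSummand i k u v
  F : ℕ → ℕ → ℕ
  F i k = i ! * k ! * stirling2 (p + 1) (i + 1) * stirling2 (p + 1) (k + 1) * S i k G
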